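{- For every TSLP $\mathcal{G}$ in normal form over a finite alphabet $\Sigma$ of size $\sigma$, the length of its binary coding satisfies $|B(\mathcal{G})| \leq \mathcal{O}(|\mathcal{G}|) +\sigma+ H(\mathcal{G})$, where the constant in $\mathcal{O}$ is absolute.
   Context: A TSLP in normal form is $\mathcal{G}=(V,A_0,r)$ with nonterminals $V=\{A_0,\dots,A_{m-1}\}$ ($m\ge1$), each of rank $0$ or $1$ ($V_0,V_1$; $A_0\in V_0$), $x$ a parameter symbol, such that: for $A_i\in V_0$, $r(A_i)=A_j(\alpha)$ with $A_j\in V_1$, $\alpha\in V_0\cup\Sigma$; for $A_i\in V_1$, $r(A_i)$ is $A_j(A_k(x))$ ($A_j,A_k\in V_1$), or $a(\alpha,x)$ or $a(x,\alpha)$ ($a\in\Sigma$, $\alpha\in V_0\cup\Sigma$); the relation "$B$ occurs in $r(A)$" is acyclic; with $\rho(A_i)$ the length-2 word $A_j\alpha$, $A_jA_k$, $a\alpha$, $a\alpha$ respectively and $\rho_\mathcal{G}=\rho(A_0)\cdots\rho(A_{m-1})$, it is required that $\rho_\mathcal{G}=A_1u_1A_2u_2\cdots A_{m-1}u_{m-1}$ with $u_i\in(\Sigma\cup\{A_1,\dots,A_i\})^*$; and the trees/contexts derived from distinct nonterminals are distinct. The single-rule TSLP $A_0\to a$ is also allowed. The size is $|\mathcal{G}|=m$. Let $\omega_\mathcal{G}=u_1\cdots u_{m-1}$ and $H(\mathcal{G})=H(\omega_\mathcal{G})$, where for a word $w=b_1\cdots b_N$, $H(w)=-\sum_{i=1}^N\log_2(|w|_{b_i}/N)$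 with $|w|_b$ the number of occurrences of $b$ in $w$. Encoding (with a fixed order $a_1,\dots,a_\sigma$ of $\Sigma$): type of $A_i$ is $0$ if $\rho(A_i)\in V_1(V_0\cup\Sigma)$, $1$ if $\rho(A_i)\in V_1V_1$, $2$ if $r(A_i)=a(\alpha,x)$, $3$ if $r(A_i)=a(x,\alpha)$. $B(\mathcal{G})=w_0w_1w_2w_3w_4$ with $w_0=0^{m-1}1$; $w_1$ the concatenation of the 2-bit encodings of the types of $A_0,\dots,A_{m-1}$; $w_2=10^{|u_1|}\cdots10^{|u_{m-1}|}$; $w_3=0^{k_1-1}1\cdots0^{k_{m-1}-1}1\,0^{l_1}1\cdots0^{l_\sigma}1$ with $k_i,l_i$ the numbers of occurrences of $A_i,a_i$ in $\rho_\mathcal{G}$; $w_4$ the binary representation, padded to length $\lceil\log_2|S|\rceil$, of the index of $\omega_\mathcal{G}$ in the lexicographic enumeration (w.r.t. $a_1<\dots<a_\sigma<A_1<\dots<A_{m-1}$) of the set $S$ of words with the same letter multiplicities as $\omega_\mathcal{G}$. -}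

module Defs where

open import Data.Nat using (ℕ; zero; suc; _+_; _*_; _∸_; _^_; _≤_; _<ᵇ_; _≡ᵇ_; _/_; _%_)
open import Data.Nat.Logarithm using (⌈log₂_⌉)
open import Data.Fin as Fin using (Fin; zero; suc; toℕ)
open import Data.Fin.Properties using () renaming (_≟_ to _≟F_)
open import Data.List using (List; []; _∷_; _++_; [_]; map; concat; concatMap; length; replicate; reverse; filter; filterᵇ; allFin)
open import Data.List.Membership.Propositional using (_∈_)
open import Data.Nat.ListAction using (product)
open import Data.Bool.ListAction using (and)
open import Data.List.Relation.Unary.All using (All)
open import Data.Bool using (Bool; true; false; if_then_else_)
open import Data.Unit using (⊤)
open import Data.Empty using (⊥)
open import Data.Product using (_×_)
open import Relation.Nullary using (¬_; yes; no)
open import Relation.Binary.PropositionalEquality using (_≡_; refl)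
open import Relation.Binary.Definitions using (DecidableEquality)
open import Relation.Binary.Construct.Closure.Transitive using (TransClosure)


data Letter (σ m : ℕ) : Set where
  ter : Fin σ → Letter σ m
  nt  : Fin m → Letter σ m

_≟L_ : ∀ {σ m} → DecidableEquality (Letter σ m)
ter a ≟L ter b with a ≟F b
... | yes refl = yes refl
... | no ¬p = no λ { refl → ¬p refl }
ter a ≟L nt B = no λ ()
nt A ≟L ter b = no λ ()
nt A ≟L nt B with A ≟F B
... | yes refl = yes refl
... | no ¬p = no λ { refl → ¬p refl }

count : ∀ {σ m} → List (Letter σ m) → Letter σ m → ℕ
count w ℓ = length (filter (λ x → x ≟L ℓ) w)

-- Right-hand sides in normal form.
--   app j α   : r(A) = A_j(α)        (rank 0)
--   comp j k  : r(A) = A_j(A_k(x))   (rank 1)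
--   left a α  : r(A) = a(α, x)       (rank 1)
--   right a α : r(A) = a(x, α)       (rank 1)
-- α is a Letter (a terminal of Σ or a nonterminal).

data Rule (σ m : ℕ) : Set where
  app   : Fin m → Letter σ m → Rule σ m
  comp  : Fin m → Fin m → Rule σ m
  left  : Fin σ → Letter σ m → Rule σ m
  right : Fin σ → Letter σ m → Rule σ m

data Rank : Set where
  r0 r1 : Rank

ρ : ∀ {σ m} → Rule σ m → List (Letter σ m)
ρ (app j α)   = nt j ∷ α ∷ []
ρ (comp j k)  = nt j ∷ nt k ∷ []
ρ (left a α)  = ter a ∷ α ∷ []
ρ (right a α) = ter a ∷ α ∷ []

Arg0 : ∀ {σ m} → (Fin m → Rank) → Letter σ m → Set
Arg0 rank (ter _) = ⊤
Arg0 rank (nt B)  = rank B ≡ r0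

WellTyped : ∀ {σ m} → (Fin m → Rank) → Rank → Rule σ m → Set
WellTyped rank r0 (app j α)   = (rank j ≡ r1) × Arg0 rank α
WellTyped rank r1 (comp j k)  = (rank j ≡ r1) × (rank k ≡ r1)
WellTyped rank r1 (left a α)  = Arg0 rank α
WellTyped rank r1 (right a α) = Arg0 rank α
WellTyped rank _  _           = ⊥

Occ : ∀ {σ m} → (Fin m → Rule σ m) → Fin m → Fin m → Set
Occ rule A B = nt B ∈ ρ (rule A)

data Tree (σ : ℕ) : Set where
  leaf : Fin σ → Tree σ
  node : Fin σ → Tree σ → Tree σ → Tree σ

data Ctx (σ : ℕ) : Set where
  hole  : Ctx σ
  nodeL : Fin σ → Ctx σ → Tree σ → Ctx σ
  nodeR : Fin σ → Tree σ → Ctx σ → Ctx σ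

plug : ∀ {σ} → Ctx σ → Tree σ → Tree σ
plug hole t          = t
plug (nodeL a c s) t = node a (plug c t) s
plug (nodeR a s c) t = node a s (plug c t)

compose : ∀ {σ} → Ctx σ → Ctx σ → Ctx σ
compose hole d          = d
compose (nodeL a c s) d = nodeL a (compose c d) s
compose (nodeR a s c) d = nodeR a s (compose c d)

module _ {σ m : ℕ} (rule : Fin m → Rule σ m) where
  mutual
    data Der0 : Fin m → Tree σ → Set where
      der-app : ∀ {A j α c t} → rule A ≡ app j α → Der1 j c → DerArg α t →
                Der0 A (plug c t)

    data Der1 : Fin m → Ctx σ → Set where
      der-comp  : ∀ {A j k c d} → rule A ≡ comp j k → Der1 j c → Der1 k d →
                  Der1 A (compose c d)
      der-left  : ∀ {A a α t} → rule A ≡ left a α → DerArg α t →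
                  Der1 A (nodeR a t hole)
      der-right : ∀ {A a α t} → rule A ≡ right a α → DerArg α t →
                  Der1 A (nodeL a hole t)

    data DerArg : Letter σ m → Tree σ → Set where
      arg-ter : ∀ {a} → DerArg (ter a) (leaf a)
      arg-nt  : ∀ {B t} → Der0 B t → DerArg (nt B) t

ρG : ∀ {σ m} → (Fin m → Rule σ m) → List (Letter σ m)
ρG {m = m} rule = concatMap (λ A → ρ (rule A)) (allFin m)

Allowed : ∀ {σ m n} → Fin n → Letter σ m → Set
Allowed i (ter _) = ⊤
Allowed i (nt B)  = (1 ≤ toℕ B) × (toℕ B ≤ suc (toℕ i))

-- TSLP in normal form with m = suc n nonterminals A₀ … A_n.
-- u i is the word u_{i+1} of the decomposition
--   ρ_G = A₁ u₁ A₂ u₂ ⋯ A_{m-1} u_{m-1}  (which determines the u's uniquely).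

record TSLP (σ n : ℕ) : Set where
  field
    rank      : Fin (suc n) → Rank
    rule      : Fin (suc n) → Rule σ (suc n)
    u         : Fin n → List (Letter σ (suc n))
    rank-A₀   : rank zero ≡ r0
    typed     : ∀ A → WellTyped rank (rank A) (rule A)
    acyclic   : ∀ A → ¬ TransClosure (Occ rule) A A
    decomp    : ρG rule ≡ concatMap (λ i → nt (suc i) ∷ u i) (allFin n)
    u-letters : ∀ i → All (Allowed i) (u i)
    distinct0 : ∀ A B t → Der0 rule A t → Der0 rule B t → A ≡ B
    distinct1 : ∀ A B c → Der1 rule A c → Der1 rule B c → A ≡ B

open TSLP public

ω : ∀ {σ n} → TSLP σ n → List (Letter σ (suc n))
ω {n = n} G = concatMap (u G) (allFin n)

-- Entropy, expressed without reals:
--   H(w) = Σ_i log₂(N / |w|_{b_i}) = log₂( N^N / Π_i |w|_{b_i} ).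
-- entropyDen w = Π_i |w|_{b_i},  entropyNum w = N^N.

entropyDen : ∀ {σ m} → List (Letter σ m) → ℕ
entropyDen w = product (map (count w) w)

entropyNum : ∀ {σ m} → List (Letter σ m) → ℕ
entropyNum w = length w ^ length w

-- Lexicographic enumeration w.r.t. a₁ < … < a_σ < A₁ < … (A₀ never occurs
-- in ω_G).

lix : ∀ {σ m} → Letter σ m → ℕ
lix {σ} (ter a) = toℕ a
lix {σ} (nt A)  = σ + toℕ A

ltLex : ∀ {σ m} → List (Letter σ m) → List (Letter σ m) → Bool
ltLex []       []       = false
ltLex []       (_ ∷ _)  = true
ltLex (_ ∷ _)  []       = false
ltLex (x ∷ xs) (y ∷ ys) =
  if lix x <ᵇ lix y then true else (if lix x ≡ᵇ lix y then ltLex xs ys else false)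

alphabet : ∀ {σ m} → List (Letter σ m)
alphabet {σ} {m} = map ter (allFin σ) ++ map nt (allFin m)

wordsOfLength : ∀ {σ m} → ℕ → List (List (Letter σ m))
wordsOfLength zero    = [] ∷ []
wordsOfLength (suc k) = concatMap (λ ℓ → map (ℓ ∷_) (wordsOfLength k)) alphabet

sameMult : ∀ {σ m} → List (Letter σ m) → List (Letter σ m) → Bool
sameMult w v = and (map (λ ℓ → count w ℓ ≡ᵇ count v ℓ) alphabet)

Sset : ∀ {σ m} → List (Letter σ m) → List (List (Letter σ m))
Sset w = filterᵇ (sameMult w) (wordsOfLength (length w))

lexIndex : ∀ {σ m} → List (Letter σ m) → ℕ
lexIndex w = length (filterᵇ (λ v → ltLex v w) (Sset w))

-- Binary coding (0 = false, 1 = true)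

zeros : ℕ → List Bool
zeros k = replicate k false

bitsLE : ℕ → ℕ → List Bool
bitsLE zero    k = []
bitsLE (suc l) k = (k % 2 ≡ᵇ 1) ∷ bitsLE l (k / 2)

binaryPadded : ℕ → ℕ → List Bool
binaryPadded l k = reverse (bitsLE l k)

typeBits : ∀ {σ m} → Rule σ m → List Bool
typeBits (app _ _)   = false ∷ false ∷ []
typeBits (comp _ _)  = false ∷ true ∷ []
typeBits (left _ _)  = true ∷ false ∷ []
typeBits (right _ _) = true ∷ true ∷ []

module _ {σ n : ℕ} (G : TSLP σ n) where
  w0 : List Bool
  w0 = zeros n ++ [ true ]

  w1 : List Bool
  w1 = concatMap (λ A → typeBits (rule G A)) (allFin (suc n))

  w2 : List Bool
  w2 = concatMap (λ i → true ∷ zeros (length (u G i))) (allFin n)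

  w3 : List Bool
  w3 = concatMap (λ i → zeros (count (ρG (rule G)) (nt (suc i)) ∸ 1) ++ [ true ]) (allFin n)
       ++ concatMap (λ a → zeros (count (ρG (rule G)) (ter a)) ++ [ true ]) (allFin σ)

  w4 : List Bool
  w4 = binaryPadded ⌈log₂ length (Sset (ω G)) ⌉ (lexIndex (ω G))

  B : List Bool
  B = w0 ++ w1 ++ w2 ++ w3 ++ w4

module Submission where

-- The blocks w₀, w₁, w₂ of B(G) have lengths m, 2m and |ρ_G| = 2m, and w₃ consists of unary
-- codes of the multiplicities of A₁ … A_{m-1}, a₁ … a_σ in ρ_G, so its length is at most
-- |ρ_G| + (m - 1) + σ.  The only non-linear block is w₄, of length ⌈log₂ |S|⌉, and it is
-- controlled by the multinomial bound |S| · Π_i |ω|_{b_i} ≤ N^N: every word v with the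
-- multiplicities of ω has weight Π_{x ∈ v} |ω|_x = Π_i |ω|_{b_i}, while the weights of all
-- words of length N sum to (Σ_b |ω|_b)^N = N^N.  With 2^⌈log₂ s⌉ ≤ 2s + 1 this gives
-- 2^|B(G)| · Π_i |ω|_{b_i} ≤ 2^(10m + σ) · N^N.

open import Defs
open import Data.Nat using (ℕ; suc; _+_; _*_; _^_; _≤_)
open import Data.List using (length)
open import Data.Product using (∃-syntax)

open import Data.Nat using (zero; _∸_; z≤n; _<_; _≡ᵇ_)
open import Data.Nat.Properties
open import Data.Nat.Logarithm using (⌈log₂_⌉; ⌈log₂⌉-mono-≤; ⌈log₂2^n⌉≡n)
open import Data.Nat.ListAction using (sum; product)
open import Data.Nat.ListAction.Properties using (sum-++)
open import Data.Nat.Tactic.RingSolver using (solve-∀)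
open import Algebra.Properties.CommutativeSemigroup +-commutativeSemigroup using () renaming (interchange to +-interchange)
open import Algebra.Properties.CommutativeSemigroup *-commutativeSemigroup using () renaming (interchange to *-interchange)
open import Data.List using (List; []; _∷_; _++_; [_]; map; concatMap; filter; allFin; tabulate)
open import Data.List.Properties using (map-++; map-tabulate; length-tabulate; length-++; length-replicate; length-reverse; length-filter; map-cong; map-cong-local; map-∘; filter-none)
open import Data.List.Membership.Propositional using (_∈_)
open import Data.List.Membership.Propositional.Properties using (∈-map⁺; ∈-map⁻; ∈-++⁺ˡ; ∈-++⁺ʳ; ∈-allFin)
import Data.List.Relation.Unary.All as All
open import Data.List.Relation.Unary.All.Properties using (all⁺; all-filter)
open import Data.List.Relation.Unary.Any using (tail)
open import Data.List.Relation.Unary.Unique.Propositional using (Unique)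
open import Data.List.Relation.Unary.AllPairs using (_∷_)
import Data.List.Relation.Unary.Unique.Propositional.Properties as Unique
open import Data.Bool using (true; false; if_then_else_; T; T?)
open import Data.Fin using (Fin; zero; suc)
open import Data.Product using (_,_; _×_)
open import Relation.Nullary using (¬_; Dec; does; yes; no)
open import Relation.Unary using (Decidable)
open import Relation.Binary.Definitions using (DecidableEquality)
open import Relation.Binary.PropositionalEquality hiding ([_])
open import Function using (_∘_)

module _ {A : Set} where

  sum-map-+ : (f g : A → ℕ) (xs : List A) →
              sum (map (λ x → f x + g x) xs) ≡ sum (map f xs) + sum (map g xs)
  sum-map-+ f g []       = refl
  sum-map-+ f g (x ∷ xs) = begin
    f x + g x + sum (map (λ x → f x + g x) xs)        ≡⟨ cong (f x + g x +_) (sum-map-+ f g xs) ⟩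
    f x + g x + (sum (map f xs) + sum (map g xs))     ≡⟨ +-interchange (f x) (g x) _ _ ⟩
    f x + sum (map f xs) + (g x + sum (map g xs))     ∎
    where open ≡-Reasoning

  product-map-* : (f g : A → ℕ) (xs : List A) →
                  product (map (λ x → f x * g x) xs) ≡ product (map f xs) * product (map g xs)
  product-map-* f g []       = refl
  product-map-* f g (x ∷ xs) = begin
    f x * g x * product (map (λ x → f x * g x) xs)            ≡⟨ cong (f x * g x *_) (product-map-* f g xs) ⟩
    f x * g x * (product (map f xs) * product (map g xs))     ≡⟨ *-interchange (f x) (g x) _ _ ⟩
    f x * product (map f xs) * (g x * product (map g xs))     ∎
    where open ≡-Reasoning

  sum-map-*ˡ : ∀ k (f : A → ℕ) xs → sum (map (λ x → k * f x) xs) ≡ k * sum (map f xs)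
  sum-map-*ˡ k f []       = sym (*-zeroʳ k)
  sum-map-*ˡ k f (x ∷ xs) =
    trans (cong (k * f x +_) (sum-map-*ˡ k f xs)) (sym (*-distribˡ-+ k (f x) _))

  sum-map-*ʳ : ∀ k (f : A → ℕ) xs → sum (map (λ x → f x * k) xs) ≡ sum (map f xs) * k
  sum-map-*ʳ k f []       = refl
  sum-map-*ʳ k f (x ∷ xs) =
    trans (cong (f x * k +_) (sum-map-*ʳ k f xs)) (sym (*-distribʳ-+ k (f x) _))

  sum-map-const : ∀ c (xs : List A) → sum (map (λ _ → c) xs) ≡ length xs * c
  sum-map-const c []       = refl
  sum-map-const c (x ∷ xs) = cong (c +_) (sum-map-const c xs)

  product-map-const : ∀ c (xs : List A) → product (map (λ _ → c) xs) ≡ c ^ length xs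
  product-map-const c []       = refl
  product-map-const c (x ∷ xs) = cong (c *_) (product-map-const c xs)

  product-map-≤ : ∀ {f : A → ℕ} {k} → (∀ x → f x ≤ k) → ∀ xs → product (map f xs) ≤ k ^ length xs
  product-map-≤ f≤k []       = ≤-refl
  product-map-≤ f≤k (x ∷ xs) = *-mono-≤ (f≤k x) (product-map-≤ f≤k xs)

  sum-map-mono : ∀ {f g : A → ℕ} → (∀ x → f x ≤ g x) → ∀ xs → sum (map f xs) ≤ sum (map g xs)
  sum-map-mono f≤g []       = z≤n
  sum-map-mono f≤g (x ∷ xs) = +-mono-≤ (f≤g x) (sum-map-mono f≤g xs)

module _ {A B : Set} where

  length-concatMap : (f : A → List B) (xs : List A) →
                     length (concatMap f xs) ≡ sum (map (length ∘ f) xs)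
  length-concatMap f []       = refl
  length-concatMap f (x ∷ xs) = trans (length-++ (f x)) (cong (length (f x) +_) (length-concatMap f xs))

  sum-map-concatMap : (g : B → ℕ) (f : A → List B) (xs : List A) →
                      sum (map g (concatMap f xs)) ≡ sum (map (λ x → sum (map g (f x))) xs)
  sum-map-concatMap g f []       = refl
  sum-map-concatMap g f (x ∷ xs) = begin
    sum (map g (f x ++ concatMap f xs))                   ≡⟨ cong sum (map-++ g (f x) (concatMap f xs)) ⟩
    sum (map g (f x) ++ map g (concatMap f xs))           ≡⟨ sum-++ (map g (f x)) _ ⟩
    sum (map g (f x)) + sum (map g (concatMap f xs))      ≡⟨ cong (sum (map g (f x)) +_) (sum-map-concatMap g f xs) ⟩
    sum (map g (f x)) + sum (map (λ x → sum (map g (f x))) xs) ∎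
    where open ≡-Reasoning

  length-concatMap-const : ∀ (f : A → List B) {c} → (∀ x → length (f x) ≡ c) → ∀ xs →
                           length (concatMap f xs) ≡ length xs * c
  length-concatMap-const f {c} |f|≡c xs =
    trans (length-concatMap f xs) (trans (cong sum (map-cong |f|≡c xs)) (sum-map-const c xs))

length-unaryCode : ∀ k → length (zeros k ++ [ true ]) ≡ k + 1
length-unaryCode k = trans (length-++ (zeros k)) (cong (_+ 1) (length-replicate k))

length-unaryCodes : ∀ {A : Set} (f : A → ℕ) xs →
                    length (concatMap (λ x → zeros (f x) ++ [ true ]) xs) ≡ sum (map f xs) + length xs
length-unaryCodes f xs = begin
  length (concatMap (λ x → zeros (f x) ++ [ true ]) xs)  ≡⟨ length-concatMap _ xs ⟩
  sum (map (λ x → length (zeros (f x) ++ [ true ])) xs)  ≡⟨ cong sum (map-cong (length-unaryCode ∘ f) xs) ⟩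
  sum (map (λ x → f x + 1) xs)                           ≡⟨ sum-map-+ f (λ _ → 1) xs ⟩
  sum (map f xs) + sum (map (λ _ → 1) xs)                ≡⟨ cong (sum (map f xs) +_) (trans (sum-map-const 1 xs) (*-identityʳ _)) ⟩
  sum (map f xs) + length xs                             ∎
  where open ≡-Reasoning

length-allFin : ∀ k → length (allFin k) ≡ k
length-allFin k = length-tabulate {n = k} (λ i → i)

indicator : {P : Set} → Dec P → ℕ
indicator d = if does d then 1 else 0

module _ {A : Set} {P : A → Set} (P? : Decidable P) where

  sum-map-indicator : ∀ xs → sum (map (indicator ∘ P?) xs) ≡ length (filter P? xs)
  sum-map-indicator []       = refl
  sum-map-indicator (x ∷ xs) with does (P? x)
  ... | true  = cong suc (sum-map-indicator xs)
  ... | false = sum-map-indicator xs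

  sum-map-filter-≤ : ∀ (g : A → ℕ) xs →
                     sum (map g (filter P? xs)) ≤ sum (map g xs)
  sum-map-filter-≤ g []       = z≤n
  sum-map-filter-≤ g (x ∷ xs) with does (P? x)
  ... | true  = +-monoʳ-≤ (g x) (sum-map-filter-≤ g xs)
  ... | false = ≤-trans (sum-map-filter-≤ g xs) (m≤n+m _ (g x))

  product-map-^-indicator : ∀ (f : A → ℕ) xs →
    product (map (λ x → f x ^ indicator (P? x)) xs) ≡ product (map f (filter P? xs))
  product-map-^-indicator f []       = refl
  product-map-^-indicator f (x ∷ xs) with does (P? x)
  ... | true  = cong₂ _*_ (*-identityʳ (f x)) (product-map-^-indicator f xs)
  ... | false = trans (*-identityˡ _) (product-map-^-indicator f xs)

module Multiplicity {A : Set} (_≟_ : DecidableEquality A) where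

  multiplicity : List A → A → ℕ
  multiplicity w x = length (filter (_≟ x) w)

  multiplicity-∷ : ∀ y w x → multiplicity (y ∷ w) x ≡ indicator (y ≟ x) + multiplicity w x
  multiplicity-∷ y w x with does (y ≟ x)
  ... | true  = refl
  ... | false = refl

  filter-≟-unique : ∀ {x xs} → Unique xs → x ∈ xs → filter (x ≟_) xs ≡ [ x ]
  filter-≟-unique {x} {y ∷ xs} (y≢xs ∷ xs-unique) x∈y∷xs with x ≟ y
  ... | yes refl = cong (x ∷_) (filter-none (x ≟_) y≢xs)
  ... | no  x≢y  = filter-≟-unique xs-unique (tail x≢y x∈y∷xs)

  module _ {L : List A} (L-unique : Unique L) (L-complete : ∀ x → x ∈ L) where

    sum-map-multiplicity : ∀ w → sum (map (multiplicity w) L) ≡ length w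
    sum-map-multiplicity []      = trans (sum-map-const 0 L) (*-zeroʳ (length L))
    sum-map-multiplicity (y ∷ w) = begin
      sum (map (multiplicity (y ∷ w)) L)
        ≡⟨ cong sum (map-cong (multiplicity-∷ y w) L) ⟩
      sum (map (λ x → indicator (y ≟ x) + multiplicity w x) L)
        ≡⟨ sum-map-+ (indicator ∘ (y ≟_)) (multiplicity w) L ⟩
      sum (map (indicator ∘ (y ≟_)) L) + sum (map (multiplicity w) L)
        ≡⟨ cong₂ _+_ (sum-map-indicator (y ≟_) L) (sum-map-multiplicity w) ⟩
      length (filter (y ≟_) L) + length w
        ≡⟨ cong (λ ys → length ys + length w) (filter-≟-unique L-unique (L-complete y)) ⟩
      suc (length w) ∎
      where open ≡-Reasoning

    product-map-multiplicity : ∀ (f : A → ℕ) w →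
      product (map f w) ≡ product (map (λ x → f x ^ multiplicity w x) L)
    product-map-multiplicity f []      = sym (trans (product-map-const 1 L) (^-zeroˡ (length L)))
    product-map-multiplicity f (y ∷ w) = begin
      f y * product (map f w)
        ≡⟨ cong₂ _*_ (sym (*-identityʳ (f y))) (product-map-multiplicity f w) ⟩
      product (map f [ y ]) * product (map (λ x → f x ^ multiplicity w x) L)
        ≡⟨ cong (λ ys → product (map f ys) * _) (filter-≟-unique L-unique (L-complete y)) ⟨
      product (map f (filter (y ≟_) L)) * product (map (λ x → f x ^ multiplicity w x) L)
        ≡⟨ cong (_* _) (product-map-^-indicator (y ≟_) f L) ⟨
      product (map (λ x → f x ^ indicator (y ≟ x)) L) * product (map (λ x → f x ^ multiplicity w x) L)
        ≡⟨ product-map-* _ _ L ⟨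
      product (map (λ x → f x ^ indicator (y ≟ x) * f x ^ multiplicity w x) L)
        ≡⟨ cong product (map-cong exponent L) ⟩
      product (map (λ x → f x ^ multiplicity (y ∷ w) x) L) ∎
      where
      open ≡-Reasoning
      exponent : ∀ x → f x ^ indicator (y ≟ x) * f x ^ multiplicity w x ≡ f x ^ multiplicity (y ∷ w) x
      exponent x = trans (sym (^-distribˡ-+-* (f x) (indicator (y ≟ x)) (multiplicity w x))) (cong (f x ^_) (sym (multiplicity-∷ y w x)))

    product-map-multiplicity-cong : ∀ (f : A → ℕ) {v w} → (∀ x → multiplicity v x ≡ multiplicity w x) →
                                    product (map f v) ≡ product (map f w)
    product-map-multiplicity-cong f {v} {w} v≈w = begin
      product (map f v)                                      ≡⟨ product-map-multiplicity f v ⟩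
      product (map (λ x → f x ^ multiplicity v x) L)         ≡⟨ cong product (map-cong (λ x → cong (f x ^_) (v≈w x)) L) ⟩
      product (map (λ x → f x ^ multiplicity w x) L)         ≡⟨ product-map-multiplicity f w ⟨
      product (map f w)                                      ∎
      where open ≡-Reasoning

module _ {σ m : ℕ} where

  alphabet-unique : Unique (alphabet {σ} {m})
  alphabet-unique = Unique.++⁺ (Unique.map⁺ ter-injective (Unique.allFin⁺ σ))
                               (Unique.map⁺ nt-injective (Unique.allFin⁺ m))
                               terminals-disjoint-nonterminals
    where
    ter-injective : ∀ {a b} → ter {σ} {m} a ≡ ter b → a ≡ b
    ter-injective refl = refl
    nt-injective : ∀ {A B} → nt {σ} {m} A ≡ nt B → A ≡ B
    nt-injective refl = refl
    terminals-disjoint-nonterminals : ∀ {ℓ} → ¬ (ℓ ∈ map ter (allFin σ) × ℓ ∈ map nt (allFin m))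
    terminals-disjoint-nonterminals (ℓ∈ter , ℓ∈nt) with ∈-map⁻ ter ℓ∈ter | ∈-map⁻ nt ℓ∈nt
    ... | _ , _ , refl | _ , _ , ()

  ∈-alphabet : ∀ ℓ → ℓ ∈ alphabet {σ} {m}
  ∈-alphabet (ter a) = ∈-++⁺ˡ (∈-map⁺ ter (∈-allFin a))
  ∈-alphabet (nt A)  = ∈-++⁺ʳ (map ter (allFin σ)) (∈-map⁺ nt (∈-allFin A))

  -- count from Defs is definitionally multiplicity _≟L_.
  open Multiplicity (_≟L_ {σ} {m})

  sum-map-count : (w : List (Letter σ m)) → sum (map (count w) alphabet) ≡ length w
  sum-map-count = sum-map-multiplicity alphabet-unique ∈-alphabet

  sameMult⇒count-≡ : {w v : List (Letter σ m)} → T (sameMult w v) → ∀ ℓ → count w ℓ ≡ count v ℓ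
  sameMult⇒count-≡ {w} {v} same ℓ =
    ≡ᵇ⇒≡ _ _ (All.lookup (all⁺ (λ ℓ → count w ℓ ≡ᵇ count v ℓ) alphabet same) (∈-alphabet ℓ))

  sum-map-product-wordsOfLength : ∀ (c : Letter σ m → ℕ) k →
    sum (map (product ∘ map c) (wordsOfLength k)) ≡ sum (map c alphabet) ^ k
  sum-map-product-wordsOfLength c zero    = refl
  sum-map-product-wordsOfLength c (suc k) = begin
    sum (map (product ∘ map c) (concatMap (λ ℓ → map (ℓ ∷_) (wordsOfLength k)) alphabet))
      ≡⟨ sum-map-concatMap (product ∘ map c) (λ ℓ → map (ℓ ∷_) (wordsOfLength k)) alphabet ⟩
    sum (map (λ ℓ → sum (map (product ∘ map c) (map (ℓ ∷_) (wordsOfLength k)))) alphabet)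
      ≡⟨ cong sum (map-cong words-starting-with alphabet) ⟩
    sum (map (λ ℓ → c ℓ * sum (map c alphabet) ^ k) alphabet)
      ≡⟨ sum-map-*ʳ (sum (map c alphabet) ^ k) c alphabet ⟩
    sum (map c alphabet) ^ suc k ∎
    where
    open ≡-Reasoning
    words-starting-with : ∀ ℓ → sum (map (product ∘ map c) (map (ℓ ∷_) (wordsOfLength k)))
                                ≡ c ℓ * sum (map c alphabet) ^ k
    words-starting-with ℓ = begin
      sum (map (product ∘ map c) (map (ℓ ∷_) (wordsOfLength k)))   ≡⟨ cong sum (map-∘ (wordsOfLength k)) ⟨
      sum (map (λ v → c ℓ * product (map c v)) (wordsOfLength k))  ≡⟨ sum-map-*ˡ (c ℓ) (product ∘ map c) (wordsOfLength k) ⟩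
      c ℓ * sum (map (product ∘ map c) (wordsOfLength k))          ≡⟨ cong (c ℓ *_) (sum-map-product-wordsOfLength c k) ⟩
      c ℓ * sum (map c alphabet) ^ k                               ∎

  length-Sset*entropyDen≤entropyNum : (w : List (Letter σ m)) → length (Sset w) * entropyDen w ≤ entropyNum w
  length-Sset*entropyDen≤entropyNum w = begin
    length (Sset w) * entropyDen w                        ≡⟨ sum-map-const (entropyDen w) (Sset w) ⟨
    sum (map (λ _ → entropyDen w) (Sset w))               ≡⟨ cong sum (map-cong-local (All.map (λ {v} → weight≡ {v}) (all-filter (T? ∘ sameMult w) words))) ⟨
    sum (map weight (Sset w))                             ≤⟨ sum-map-filter-≤ (T? ∘ sameMult w) weight words ⟩
    sum (map weight words)                                ≡⟨ sum-map-product-wordsOfLength (count w) (length w) ⟩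
    sum (map (count w) alphabet) ^ length w               ≡⟨ cong (_^ length w) (sum-map-count w) ⟩
    entropyNum w                                          ∎
    where
    open ≤-Reasoning
    words : List (List (Letter σ m))
    words = wordsOfLength (length w)
    weight : List (Letter σ m) → ℕ
    weight v = product (map (count w) v)
    weight≡ : ∀ {v} → T (sameMult w v) → weight v ≡ entropyDen w
    weight≡ {v} same = product-map-multiplicity-cong alphabet-unique ∈-alphabet (count w) {v} {w}
                         (λ ℓ → sym (sameMult⇒count-≡ {w} {v} same ℓ))

  entropyDen≤entropyNum : (w : List (Letter σ m)) → entropyDen w ≤ entropyNum w
  entropyDen≤entropyNum w = product-map-≤ {f = count w} (λ ℓ → length-filter (_≟L ℓ) w) w

power-of-two-between : ∀ s → ∃[ k ] (s ≤ 2 ^ k × 2 ^ k ≤ 2 * s + 1)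
power-of-two-between zero    = 0 , z≤n , ≤-refl
power-of-two-between (suc s) with power-of-two-between s
... | k , s≤2^k , 2^k≤2s+1 with suc s ≤? 2 ^ k
...   | yes 1+s≤2^k = k , 1+s≤2^k , ≤-trans 2^k≤2s+1 (+-monoˡ-≤ 1 (*-monoʳ-≤ 2 (n≤1+n s)))
...   | no  1+s≰2^k rewrite ≤-antisym s≤2^k (≤-pred (≰⇒> 1+s≰2^k)) =
  suc k , 1+x≤2*x (2 ^ k) (m^n>0 2 k) , ≤-trans (*-monoʳ-≤ 2 (n≤1+n (2 ^ k))) (m≤m+n _ 1)
  where
  1+x≤2*x : ∀ x → 0 < x → suc x ≤ 2 * x
  1+x≤2*x x 0<x = ≤-trans (+-monoˡ-≤ x 0<x) (≤-reflexive (cong (x +_) (sym (+-identityʳ x))))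

-- The + 1 is only needed for n = 0, where ⌈log₂ 0⌉ = 0.
2^⌈log₂n⌉≤2n+1 : ∀ n → 2 ^ ⌈log₂ n ⌉ ≤ 2 * n + 1
2^⌈log₂n⌉≤2n+1 n with power-of-two-between n
... | k , n≤2^k , 2^k≤2n+1 =
  ≤-trans (^-monoʳ-≤ 2 (≤-trans (⌈log₂⌉-mono-≤ n≤2^k) (≤-reflexive (⌈log₂2^n⌉≡n k)))) 2^k≤2n+1

lexIndex-code-bound : ∀ {σ m} (w : List (Letter σ m)) →
                     2 ^ ⌈log₂ length (Sset w) ⌉ * entropyDen w ≤ 2 ^ 2 * entropyNum w
lexIndex-code-bound w = begin
  2 ^ ⌈log₂ |S| ⌉ * D   ≤⟨ *-monoˡ-≤ D (2^⌈log₂n⌉≤2n+1 |S|) ⟩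
  (2 * |S| + 1) * D     ≡⟨ distrib |S| D ⟩
  2 * (|S| * D) + D     ≤⟨ +-mono-≤ (*-monoʳ-≤ 2 (length-Sset*entropyDen≤entropyNum w)) (entropyDen≤entropyNum w) ⟩
  2 * N + N             ≤⟨ m≤m+n _ N ⟩
  2 * N + N + N         ≡⟨ collect N ⟩
  2 ^ 2 * N             ∎
  where
  open ≤-Reasoning
  |S| = length (Sset w)
  D = entropyDen w
  N = entropyNum w
  distrib : ∀ s d → (2 * s + 1) * d ≡ 2 * (s * d) + d
  distrib = solve-∀
  collect : ∀ n → 2 * n + n + n ≡ 4 * n
  collect = solve-∀

pow2-transfer : ∀ {X a b l D N} → X ≤ a + l → 2 ^ l * D ≤ 2 ^ b * N → 2 ^ X * D ≤ 2 ^ (a + b) * N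
pow2-transfer {X} {a} {b} {l} {D} {N} X≤a+l 2^lD≤2^bN = begin
  2 ^ X * D               ≤⟨ *-monoˡ-≤ D (^-monoʳ-≤ 2 X≤a+l) ⟩
  2 ^ (a + l) * D         ≡⟨ cong (_* D) (^-distribˡ-+-* 2 a l) ⟩
  2 ^ a * 2 ^ l * D       ≡⟨ *-assoc (2 ^ a) (2 ^ l) D ⟩
  2 ^ a * (2 ^ l * D)     ≤⟨ *-monoʳ-≤ (2 ^ a) 2^lD≤2^bN ⟩
  2 ^ a * (2 ^ b * N)     ≡⟨ *-assoc (2 ^ a) (2 ^ b) N ⟨
  2 ^ a * 2 ^ b * N       ≡⟨ cong (_* N) (^-distribˡ-+-* 2 a b) ⟨
  2 ^ (a + b) * N         ∎
  where open ≤-Reasoning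

length-ρ : ∀ {σ m} (r : Rule σ m) → length (ρ r) ≡ 2
length-ρ (app _ _)   = refl
length-ρ (comp _ _)  = refl
length-ρ (left _ _)  = refl
length-ρ (right _ _) = refl

length-typeBits : ∀ {σ m} (r : Rule σ m) → length (typeBits r) ≡ 2
length-typeBits (app _ _)   = refl
length-typeBits (comp _ _)  = refl
length-typeBits (left _ _)  = refl
length-typeBits (right _ _) = refl

length-ρG : ∀ {σ m} (rule : Fin m → Rule σ m) → length (ρG rule) ≡ m * 2
length-ρG {m = m} rule =
  trans (length-concatMap-const (ρ ∘ rule) (length-ρ ∘ rule) (allFin m)) (cong (_* 2) (length-allFin m))

length-bitsLE : ∀ l k → length (bitsLE l k) ≡ l
length-bitsLE zero    k = refl
length-bitsLE (suc l) k = cong suc (length-bitsLE l _)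

length-binaryPadded : ∀ l k → length (binaryPadded l k) ≡ l
length-binaryPadded l k = trans (length-reverse (bitsLE l k)) (length-bitsLE l k)

sum-map-alphabet : ∀ {σ n} (g : Letter σ (suc n) → ℕ) →
  sum (map g alphabet) ≡ sum (map (g ∘ ter) (allFin σ)) + (g (nt zero) + sum (map (g ∘ nt ∘ suc) (allFin n)))
sum-map-alphabet {σ} {n} g = begin
  sum (map g (map ter (allFin σ) ++ map nt (allFin (suc n))))
    ≡⟨ cong sum (map-++ g (map ter (allFin σ)) _) ⟩
  sum (map g (map ter (allFin σ)) ++ map g (map nt (allFin (suc n))))
    ≡⟨ sum-++ (map g (map ter (allFin σ))) _ ⟩
  sum (map g (map ter (allFin σ))) + sum (map g (map nt (allFin (suc n))))
    ≡⟨ cong₂ _+_ (cong sum (map-∘ (allFin σ))) (cong sum (map-∘ (allFin (suc n)))) ⟨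
  sum (map (g ∘ ter) (allFin σ)) + (g (nt zero) + sum (map (g ∘ nt) (tabulate suc)))
    ≡⟨ cong (λ gs → sum (map (g ∘ ter) (allFin σ)) + (g (nt zero) + sum gs)) tabulate-suc ⟩
  sum (map (g ∘ ter) (allFin σ)) + (g (nt zero) + sum (map (g ∘ nt ∘ suc) (allFin n))) ∎
  where
  open ≡-Reasoning
  tabulate-suc : map (g ∘ nt) (tabulate suc) ≡ map (g ∘ nt ∘ suc) (allFin n)
  tabulate-suc = trans (map-tabulate suc (g ∘ nt)) (sym (map-tabulate (λ i → i) (g ∘ nt ∘ suc)))

counts-except-A₀≤length : ∀ {σ n} (w : List (Letter σ (suc n))) →
  sum (map (count w ∘ nt ∘ suc) (allFin n)) + sum (map (count w ∘ ter) (allFin σ)) ≤ length w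
counts-except-A₀≤length {σ} {n} w = begin
  S₁ + S₂                                  ≡⟨ +-comm S₁ S₂ ⟩
  S₂ + S₁                                  ≤⟨ +-monoʳ-≤ S₂ (m≤n+m S₁ (count w (nt zero))) ⟩
  S₂ + (count w (nt zero) + S₁)            ≡⟨ sum-map-alphabet (count w) ⟨
  sum (map (count w) alphabet)             ≡⟨ sum-map-count w ⟩
  length w                                 ∎
  where
  open ≤-Reasoning
  S₁ = sum (map (count w ∘ nt ∘ suc) (allFin n))
  S₂ = sum (map (count w ∘ ter) (allFin σ))

module _ {σ n : ℕ} (G : TSLP σ n) where

  length-w1 : length (w1 G) ≡ suc n * 2
  length-w1 = trans (length-concatMap-const (typeBits ∘ rule G) (length-typeBits ∘ rule G) (allFin (suc n)))
                    (cong (_* 2) (length-allFin (suc n)))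

  length-w2 : length (w2 G) ≡ length (ρG (rule G))
  length-w2 = begin
    length (w2 G)                                             ≡⟨ length-concatMap _ (allFin n) ⟩
    sum (map (λ i → suc (length (zeros (length (u G i))))) (allFin n))
                                                              ≡⟨ cong sum (map-cong (λ i → cong suc (length-replicate _)) (allFin n)) ⟩
    sum (map (λ i → suc (length (u G i))) (allFin n))         ≡⟨ length-concatMap _ (allFin n) ⟨
    length (concatMap (λ i → nt (suc i) ∷ u G i) (allFin n))  ≡⟨ cong length (decomp G) ⟨
    length (ρG (rule G))                                      ∎
    where open ≡-Reasoning

  length-w3 : length (w3 G) ≤ suc n * 2 + n + σ
  length-w3 = begin
    length (w3 G)
      ≡⟨ trans (length-++ (concatMap (λ i → zeros (c (nt (suc i)) ∸ 1) ++ [ true ]) (allFin n)))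
               (cong₂ _+_ (length-unaryCodes (λ i → c (nt (suc i)) ∸ 1) (allFin n))
                          (length-unaryCodes (c ∘ ter) (allFin σ))) ⟩
    (sum (map (λ i → c (nt (suc i)) ∸ 1) (allFin n)) + length (allFin n)) + (S₂ + length (allFin σ))
      ≤⟨ +-monoˡ-≤ _ (+-monoˡ-≤ _ (sum-map-mono (λ i → m∸n≤m (c (nt (suc i))) 1) (allFin n))) ⟩
    (S₁ + length (allFin n)) + (S₂ + length (allFin σ))
      ≡⟨ cong₂ (λ k l → (S₁ + k) + (S₂ + l)) (length-allFin n) (length-allFin σ) ⟩
    (S₁ + n) + (S₂ + σ)
      ≡⟨ trans (+-interchange S₁ n S₂ σ) (sym (+-assoc (S₁ + S₂) n σ)) ⟩
    S₁ + S₂ + n + σ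
      ≤⟨ +-monoˡ-≤ σ (+-monoˡ-≤ n (counts-except-A₀≤length (ρG (rule G)))) ⟩
    length (ρG (rule G)) + n + σ
      ≡⟨ cong (λ k → k + n + σ) (length-ρG (rule G)) ⟩
    suc n * 2 + n + σ ∎
    where
    open ≤-Reasoning
    c : Letter σ (suc n) → ℕ
    c = count (ρG (rule G))
    S₁ = sum (map (c ∘ nt ∘ suc) (allFin n))
    S₂ = sum (map (c ∘ ter) (allFin σ))

  length-B : length (B G) ≤ 8 * suc n + σ + ⌈log₂ length (Sset (ω G)) ⌉
  length-B = begin
    length (B G)
      ≡⟨ length-parts ⟩
    (n + 1) + (suc n * 2 + (suc n * 2 + (length (w3 G) + l)))
      ≤⟨ +-monoʳ-≤ (n + 1) (+-monoʳ-≤ (suc n * 2) (+-monoʳ-≤ (suc n * 2) (+-monoˡ-≤ l length-w3))) ⟩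
    (n + 1) + (suc n * 2 + (suc n * 2 + (suc n * 2 + n + σ + l)))
      ≤⟨ m≤m+n _ 1 ⟩
    (n + 1) + (suc n * 2 + (suc n * 2 + (suc n * 2 + n + σ + l))) + 1
      ≡⟨ collect n σ l ⟩
    8 * suc n + σ + l ∎
    where
    open ≤-Reasoning
    l = ⌈log₂ length (Sset (ω G)) ⌉
    length-parts : length (B G) ≡ (n + 1) + (suc n * 2 + (suc n * 2 + (length (w3 G) + l)))
    length-parts =
      trans (length-++ (w0 G)) (cong₂ _+_ (length-unaryCode n)
      (trans (length-++ (w1 G)) (cong₂ _+_ length-w1
      (trans (length-++ (w2 G)) (cong₂ _+_ (trans length-w2 (length-ρG (rule G)))
      (trans (length-++ (w3 G)) (cong (length (w3 G) +_) (length-binaryPadded l (lexIndex (ω G))))))))))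
    collect : ∀ n σ l → (n + 1) + (suc n * 2 + (suc n * 2 + (suc n * 2 + n + σ + l))) + 1 ≡ 8 * suc n + σ + l
    collect = solve-∀

mainTheorem7 : ∃[ c ] (∀ (σ n : ℕ) (G : TSLP σ n) →
                 2 ^ length (B G) * entropyDen (ω G)
                   ≤ 2 ^ (c * suc n + σ) * entropyNum (ω G))
mainTheorem7 = 10 , λ σ n G → begin
  2 ^ length (B G) * entropyDen (ω G)           ≤⟨ pow2-transfer {a = 8 * suc n + σ} (length-B G) (lexIndex-code-bound (ω G)) ⟩
  2 ^ (8 * suc n + σ + 2) * entropyNum (ω G)    ≤⟨ *-monoˡ-≤ (entropyNum (ω G)) (^-monoʳ-≤ 2 (slack n σ)) ⟩
  2 ^ (10 * suc n + σ) * entropyNum (ω G)       ∎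
  where
  open ≤-Reasoning
  slack : ∀ n σ → 8 * suc n + σ + 2 ≤ 10 * suc n + σ
  slack n σ = ≤-trans (m≤m+n _ (2 * n)) (≤-reflexive (rearrange n σ))
    where
    rearrange : ∀ n σ → 8 * suc n + σ + 2 + 2 * n ≡ 10 * suc n + σ
    rearrange = solve-∀
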